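{- If $T$ is a locally finite tree and $r$ is a vertex of $T$, then $m(T,r)=1$.
   Context: A tree is locally finite if every vertex has finite degree. Two rooted trees $(T,r)$, $(T',r')$ are twins if there are injective graph homomorphisms $\phi\colon T\to T'$, $\psi\colon T'\to T$ with $\phi(r)=r'$, $\psi(r')=r$; they are isomorphic if some graph isomorphism $T\to T'$ maps $r$ to $r'$. The twin number $m(T,r)$ is the number of isomorphism classes of rooted trees twinned with $(T,r)$. -}

module Defs where

open import Level using (0ℓ)
open import Data.Nat using (ℕ; zero; suc; _≤_)
open import Data.List using (List; []; _∷_)
open import Data.List.Membership.Propositional using (_∈_)
open import Data.List.Relation.Unary.Unique.Propositional using (Unique)
open import Data.Product using (Σ; _×_; _,_)
open import Data.Empty using (⊥)
open import Relation.Nullary using (¬_)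
open import Relation.Binary.PropositionalEquality using (_≡_)
open import Function.Definitions using (Injective; Inverseˡ; Inverseʳ)

record Graph : Set₁ where
  field
    V     : Set
    _~_   : V → V → Set
    ~-sym : ∀ {u v} → u ~ v → v ~ u
    ~-irr : ∀ {v} → ¬ (v ~ v)
open Graph public

data Walk (G : Graph) : V G → V G → Set where
  stop : ∀ {v} → Walk G v v
  step : ∀ {u w v} → _~_ G u w → Walk G w v → Walk G u v

len : ∀ {G u v} → Walk G u v → ℕ
len stop       = zero
len (step _ p) = suc (len p)

verts : ∀ {G u v} → Walk G u v → List (V G)
verts {u = u} stop       = u ∷ []
verts {u = u} (step _ p) = u ∷ verts p

Connected : Graph → Set
Connected G = ∀ (u v : V G) → Walk G u v

-- a cycle: a path v0 ... vk (distinct vertices, k ≥ 2) with vk ~ v0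
HasCycle : Graph → Set
HasCycle G = Σ (V G) λ u → Σ (V G) λ v → Σ (Walk G u v) λ p →
  (2 ≤ len p) × Unique (verts p) × _~_ G v u

IsTree : Graph → Set
IsTree G = Connected G × ¬ HasCycle G

LocallyFinite : Graph → Set
LocallyFinite G = ∀ (v : V G) → Σ (List (V G)) λ ns → ∀ w → _~_ G v w → w ∈ ns

record RootedEmbedding (G : Graph) (r : V G) (H : Graph) (s : V H) : Set where
  field
    map      : V G → V H
    hom      : ∀ {u v} → _~_ G u v → _~_ H (map u) (map v)
    injective : Injective _≡_ _≡_ map
    root     : map r ≡ s

Twins : (G : Graph) → V G → (H : Graph) → V H → Set
Twins G r H s = RootedEmbedding G r H s × RootedEmbedding H s G r

record RootedIso (G : Graph) (r : V G) (H : Graph) (s : V H) : Set where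
  field
    to       : V G → V H
    from     : V H → V G
    inverseˡ : ∀ y → to (from y) ≡ y
    inverseʳ : ∀ x → from (to x) ≡ x
    hom      : ∀ {u v} → _~_ G u v → _~_ H (to u) (to v)
    homInv   : ∀ {u v} → _~_ H (to u) (to v) → _~_ G u v
    root     : to r ≡ s

module Submission where

-- Let φ : (T,r) → (T',r') and ψ : (T',r') → (T,r) be rooted embeddings, and
-- put θ = ψ ∘ φ, an injective rooted self-embedding of (T,r).  The whole
-- argument is a finiteness argument about θ, using only that T is connected
-- and locally finite:
--   * an injective self-map of a set that maps a finite subset P into itself
--     is onto P (pigeonhole on an orbit, then cancel by injectivity);
--   * in a locally finite graph the layer of vertices joined to r by a walk
--     of length n is finite, and so is the set of edges leaving that layer;
--   * θ maps walks to walks of equal length and fixes r, so it maps each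
--     layer, and each layer's edge set, into itself.
-- Hence θ is surjective and reflects adjacency.  Then φ is a bijection
-- (φ is injective, and ψ ∘ φ surjective with ψ injective makes φ surjective)
-- that reflects adjacency, i.e. a rooted isomorphism.  The identity gives
-- the twin (T,r) itself, so (T,r) is its only twin up to isomorphism.

open import Defs
open import Level using (0ℓ)
open import Axiom.ExcludedMiddle using (ExcludedMiddle)
open import Data.Nat using (ℕ; zero; suc; _<_; s<s)
open import Data.Nat.Properties using (n<1+n; suc-injective)
open import Data.Nat.GeneralisedArithmetic using (fold)
open import Data.Fin as Fin using (Fin; toℕ)
open import Data.Fin.Properties using (pigeonhole)
open import Data.List using (List; []; _∷_; length; lookup; concatMap; cartesianProduct)
open import Data.List.Relation.Unary.Any using (here; index)
open import Data.List.Relation.Unary.Any.Properties using (lookup-index)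
open import Data.List.Membership.Propositional using (_∈_; lose)
open import Data.List.Membership.Propositional.Properties
  using (∈-concatMap⁺; ∈-cartesianProduct⁺)
open import Data.Product using (Σ; ∃; ∃₂; _×_; _,_; proj₁; proj₂)
open import Function.Definitions using (Injective; StrictlySurjective)
open import Relation.Binary.PropositionalEquality
  using (_≡_; refl; sym; trans; cong; cong₂; subst; module ≡-Reasoning)

Enumerated : {A : Set} → (A → Set) → Set
Enumerated {A} P = Σ (List A) λ xs → ∀ x → P x → x ∈ xs

-- Dynamics of an injective self-map f, with fold y f n = fⁿ(y).
module InjectiveEndo {A : Set} (f : A → A) (f-inj : Injective _≡_ _≡_ f) where

  -- If an orbit repeats, fⁱ(y) = fʲ(y) with i < j, then injectivity lets us
  -- cancel fⁱ: the orbit returns to y itself after a positive number of steps.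
  orbit-returns : ∀ y {i j} → i < j → fold y f i ≡ fold y f j →
                  ∃ λ m → y ≡ fold y f (suc m)
  orbit-returns y {zero}  {suc j} _         fⁱ≡fʲ = j , fⁱ≡fʲ
  orbit-returns y {suc i} {suc j} (s<s i<j) fⁱ≡fʲ =
    orbit-returns y i<j (f-inj fⁱ≡fʲ)

  orbit-invariant : (P : A → Set) → (∀ {x} → P x → P (f x)) →
    ∀ {y} → P y → ∀ n → P (fold y f n)
  orbit-invariant P f-pres Py zero    = Py
  orbit-invariant P f-pres Py (suc n) = f-pres (orbit-invariant P f-pres Py n)

  -- Pigeonhole: the |xs|+1 points y, f y, …, f^|xs| y all lie in xs, so two
  -- of them coincide, and hence y = f^(m+1) y = f (f^m y) with f^m y ∈ P.
  onto-invariant-finite : (P : A → Set) → (∀ {x} → P x → P (f x)) →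
    Enumerated P → ∀ y → P y → Σ A λ x → P x × f x ≡ y
  onto-invariant-finite P f-pres (xs , complete) y Py =
    preimage (pigeonhole (n<1+n (length xs)) (λ n → index (located (toℕ n))))
    where
    Pfⁿy : ∀ n → P (fold y f n)
    Pfⁿy = orbit-invariant P f-pres Py

    located : ∀ n → fold y f n ∈ xs
    located n = complete (fold y f n) (Pfⁿy n)

    same-point : ∀ i j → index (located i) ≡ index (located j) →
                 fold y f i ≡ fold y f j
    same-point i j same = trans (lookup-index (located i))
      (trans (cong (lookup xs) same) (sym (lookup-index (located j))))

    preimage : (∃₂ λ (i j : Fin (suc (length xs))) → i Fin.< j ×
                 index (located (toℕ i)) ≡ index (located (toℕ j))) →
               Σ A λ x → P x × f x ≡ y
    preimage (i , j , i<j , same)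
      with orbit-returns y i<j (same-point (toℕ i) (toℕ j) same)
    ... | m , y≡fᵐ⁺¹y = fold y f m , Pfⁿy m , sym y≡fᵐ⁺¹y

mapWalk : ∀ {G H : Graph} (h : V G → V H) → (∀ {u v} → _~_ G u v → _~_ H (h u) (h v)) →
  ∀ {u v} → Walk G u v → Walk H (h u) (h v)
mapWalk h h-hom stop       = stop
mapWalk h h-hom (step e p) = step (h-hom e) (mapWalk h h-hom p)

len-mapWalk : ∀ {G H : Graph} (h : V G → V H) (h-hom : ∀ {u v} → _~_ G u v → _~_ H (h u) (h v)) →
  ∀ {u v} (p : Walk G u v) → len (mapWalk {G} {H} h h-hom p) ≡ len p
len-mapWalk h h-hom stop       = refl
len-mapWalk h h-hom (step e p) = cong suc (len-mapWalk h h-hom p)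

len-subst : ∀ {G : Graph} {u a b} (a≡b : a ≡ b) (p : Walk G u a) →
  len (subst (Walk G u) a≡b p) ≡ len p
len-subst refl p = refl

idᴱ : ∀ {G r} → RootedEmbedding G r G r
idᴱ = record { map = λ x → x ; hom = λ e → e ; injective = λ e → e ; root = refl }

_∘ᴱ_ : ∀ {G r H s K t} → RootedEmbedding H s K t → RootedEmbedding G r H s →
  RootedEmbedding G r K t
ψ ∘ᴱ φ = record
  { map       = λ x → Ψ.map (Φ.map x)
  ; hom       = λ e → Ψ.hom (Φ.hom e)
  ; injective = λ e → Φ.injective (Ψ.injective e)
  ; root      = trans (cong Ψ.map Φ.root) Ψ.root }
  where
  module Φ = RootedEmbedding φ
  module Ψ = RootedEmbedding ψ

module Layers (G : Graph) (lf : LocallyFinite G) (r : V G) where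

  Layer : ℕ → V G → Set
  Layer n v = Σ (Walk G v r) λ p → len p ≡ n

  LayerEdge : ℕ → V G × V G → Set
  LayerEdge n (a , b) = Layer n a × _~_ G a b

  neighbours : V G → List (V G)
  neighbours v = proj₁ (lf v)

  -- Layer n+1 consists of neighbours of layer n, so induction enumerates it.
  layer-enumerated : ∀ n → Enumerated (Layer n)
  layer-enumerated zero = r ∷ [] , λ { v (stop , refl) → here refl }
  layer-enumerated (suc n) = concatMap neighbours xs , complete
    where
    xs : List (V G)
    xs = proj₁ (layer-enumerated n)

    complete : ∀ v → Layer (suc n) v → v ∈ concatMap neighbours xs
    complete v (step {w = w} v~w p , len≡1+n) = ∈-concatMap⁺ neighbours (lose w∈xs v∈nw)
      where
      w∈xs : w ∈ xs
      w∈xs = proj₂ (layer-enumerated n) w (p , suc-injective len≡1+n)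
      v∈nw : v ∈ neighbours w
      v∈nw = proj₂ (lf w) v (~-sym G v~w)

  -- An edge leaving layer n ends in layer n+1, so it is a pair from the
  -- product of two finite layers.
  layer-edges-enumerated : ∀ n → Enumerated (LayerEdge n)
  layer-edges-enumerated n = cartesianProduct (enum n) (enum (suc n)) , complete
    where
    enum : ℕ → List (V G)
    enum k = proj₁ (layer-enumerated k)

    complete : ∀ ab → LayerEdge n ab → ab ∈ cartesianProduct (enum n) (enum (suc n))
    complete (a , b) ((p , refl) , a~b) = ∈-cartesianProduct⁺
      (proj₂ (layer-enumerated n) a (p , refl))
      (proj₂ (layer-enumerated (suc n)) b (step (~-sym G a~b) p , refl))

module SelfEmbedding (G : Graph) (conn : Connected G) (lf : LocallyFinite G) (r : V G)
                     (θ : RootedEmbedding G r G r) where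
  open RootedEmbedding θ
  open Layers G lf r

  -- θ preserves walk lengths and fixes r, so it maps each layer into itself.
  layer-invariant : ∀ {n v} → Layer n v → Layer n (map v)
  layer-invariant {n} (p , len-p) = subst (Walk G (map _)) root θp , (begin
      len (subst (Walk G (map _)) root θp) ≡⟨ len-subst root θp ⟩
      len θp                               ≡⟨ len-mapWalk map hom p ⟩
      len p                                ≡⟨ len-p ⟩
      n                                    ∎)
    where
    open ≡-Reasoning
    θp : Walk G (map _) (map r)
    θp = mapWalk map hom p

  own-layer : ∀ v → Layer (len (conn v r)) v
  own-layer v = conn v r , refl

  -- y lies in a finite θ-invariant layer, on which θ is therefore onto.
  surjective : StrictlySurjective _≡_ map
  surjective y
    with InjectiveEndo.onto-invariant-finite map injective (Layer n) layer-invariant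
           (layer-enumerated n) y (own-layer y)
    where n = len (conn y r)
  ... | x , _ , θx≡y = x , θx≡y

  map² : V G × V G → V G × V G
  map² (a , b) = map a , map b

  map²-injective : Injective _≡_ _≡_ map²
  map²-injective {a , b} {c , d} eq =
    cong₂ _,_ (injective (cong proj₁ eq)) (injective (cong proj₂ eq))

  -- The edges leaving a layer form a finite θ-invariant set, so the edge
  -- (θu, θv) is the image of an edge, which must be (u, v) by injectivity.
  reflects-adjacency : ∀ {u v} → _~_ G (map u) (map v) → _~_ G u v
  reflects-adjacency {u} {v} θu~θv
    with InjectiveEndo.onto-invariant-finite map² map²-injective (LayerEdge n)
           (λ (layer , a~b) → layer-invariant layer , hom a~b)
           (layer-edges-enumerated n) (map u , map v) (layer-invariant (own-layer u) , θu~θv)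
    where n = len (conn u r)
  ... | (a , b) , (_ , a~b) , θab≡θuv with map²-injective {a , b} {u , v} θab≡θuv
  ... | refl = a~b

twin-embedding-is-iso : ∀ {G r H s} → Connected G → LocallyFinite G →
  Twins G r H s → RootedIso G r H s
twin-embedding-is-iso {G} {r} {H} {s} conn lf (φ , ψ) = record
  { to = Φ.map ; from = from ; inverseˡ = inverseˡ ; inverseʳ = inverseʳ
  ; hom = Φ.hom ; homInv = λ e → θ.reflects-adjacency (Ψ.hom e) ; root = Φ.root }
  where
  module Φ = RootedEmbedding φ
  module Ψ = RootedEmbedding ψ
  module θ = SelfEmbedding G conn lf r (ψ ∘ᴱ φ)

  from : V H → V G
  from y = proj₁ (θ.surjective (Ψ.map y))

  inverseˡ : ∀ y → Φ.map (from y) ≡ y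
  inverseˡ y = Ψ.injective (proj₂ (θ.surjective (Ψ.map y)))

  inverseʳ : ∀ x → from (Φ.map x) ≡ x
  inverseʳ x = RootedEmbedding.injective (ψ ∘ᴱ φ) (proj₂ (θ.surjective (Ψ.map (Φ.map x))))

-- Corollary 1: a locally finite tree rooted at r is twinned with itself, and
-- every rooted tree twinned with it is isomorphic to it, i.e. m(T,r) = 1.
corollary1 : ExcludedMiddle 0ℓ →
    (T : Graph) → IsTree T → LocallyFinite T → (r : V T) →
    Twins T r T r ×
    ((T' : Graph) → IsTree T' → (r' : V T') →
    Twins T r T' r' → RootedIso T r T' r')
corollary1 _ T (conn , _) lf r =
  (idᴱ , idᴱ) , λ T' _ r' twins → twin-embedding-is-iso conn lf twins
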